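{- In the linear multirole logic LMRL over a set of roles $\mathcal{R}$, for every sequent $\Gamma$ and every formula $A$: if $\vdash\Gamma,[\emptyset]A$ is derivable, then $\vdash\Gamma$ is derivable.
   Context: Fix a set $\mathcal{R}$ (the set of roles), possibly infinite. For $R\subseteq\mathcal{R}$ write $\overline{R}=\mathcal{R}\setminus R$; $R_1\uplus\cdots\uplus R_n$ denotes the union of pairwise disjoint sets. A filter on $\mathcal{R}$ is a set $\mathcal{F}$ of subsets of $\mathcal{R}$ with $\mathcal{R}\in\mathcal{F}$, upward closed under inclusion, and closed under binary intersection; an ultrafilter $\mathcal{U}$ is a filter such that for every $R\subseteq\mathcal{R}$, $R\in\mathcal{U}$ or $\overline{R}\in\mathcal{U}$. An endomorphism is any $f:\mathcal{R}\to\mathcal{R}$; $f^{ -1}(R)$ is the preimage. Terms $t$, atomic formulas $a$ are standard first-order. Formulas of LMRL: $A ::= a \mid \neg_f(A) \mid A_1\wedge_{\mathcal{U}}A_2 \mid A\supset_{f,\mathcal{U}}B \mid (!A)_{\mathcal{U}} \mid \forall_{\mathcal{U}}(\lambda x.A)$ ($f$ endomorphism, $\mathcal{U}$ ultrafilter); $A[x:=t]$ is substitution. An i-formula is $[R]A$ with $R\subseteq\mathcal{R}$; a sequent $\Gamma$ is a finite multiset of i-formulas, commas denoting multiset union. $?(\Gamma)$ denotes a sequent each of whose i-formulas has the form $[R'](!B)_{\mathcal{U}'}$ with $R'\notin\mathcal{U}'$. Derivable sequents are generated by: (Id) $\vdash[R_1]a,\dots,[R_n]a$ for atomic $a$, $n\ge1$,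 $R_1\uplus\cdots\uplus R_n=\mathcal{R}$; ($\neg$) from $\vdash\Gamma,[f^{ -1}(R)]A$ infer $\vdash\Gamma,[R]\neg_f(A)$; ($\supset$-neg) if $R\notin\mathcal{U}$, from $\vdash\Gamma,[f^{ -1}(R)]A,[R]B$ infer $\vdash\Gamma,[R](A\supset_{f,\mathcal{U}}B)$; ($\supset$-pos) if $R\in\mathcal{U}$, from $\vdash\Gamma_1,[f^{ -1}(R)]A$ and $\vdash\Gamma_2,[R]B$ infer $\vdash\Gamma_1,\Gamma_2,[R](A\supset_{f,\mathcal{U}}B)$; ($\wedge$-neg) if $R\notin\mathcal{U}$, from $\vdash\Gamma,[R]A$ or from $\vdash\Gamma,[R]B$ infer $\vdash\Gamma,[R](A\wedge_{\mathcal{U}}B)$; ($\wedge$-pos) if $R\in\mathcal{U}$, from $\vdash\Gamma,[R]A$ and $\vdash\Gamma,[R]B$ infer $\vdash\Gamma,[R](A\wedge_{\mathcal{U}}B)$; ($!$-pos) if $R\in\mathcal{U}$, from $\vdash ?(\Gamma),[R]A$ infer $\vdash ?(\Gamma),[R](!A)_{\mathcal{U}}$; ($!$-neg-weaken) if $R\notin\mathcal{U}$, from $\vdash\Gamma$ infer $\vdash\Gamma,[R](!A)_{\mathcal{U}}$; ($!$-neg-derelict) if $R\notin\mathcal{U}$, from $\vdash\Gamma,[R]A$ infer $\vdash\Gamma,[R](!A)_{\mathcal{U}}$; ($!$-neg-contract) if $R\notin\mathcal{U}$, from $\vdash\Gamma,[R](!A)_{\mathcal{U}},[R](!A)_{\mathcal{U}}$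 infer $\vdash\Gamma,[R](!A)_{\mathcal{U}}$; ($\forall$-neg) if $R\notin\mathcal{U}$, from $\vdash\Gamma,[R]A[x:=t]$ infer $\vdash\Gamma,[R]\forall_{\mathcal{U}}(\lambda x.A)$; ($\forall$-pos) if $R\in\mathcal{U}$ and $x$ not free in $\Gamma$, from $\vdash\Gamma,[R]A$ infer $\vdash\Gamma,[R]\forall_{\mathcal{U}}(\lambda x.A)$. -}

module Defs where

open import Data.Bool using (Bool; true; false; not; _∧_)
open import Data.Nat using (ℕ; zero; suc)
open import Data.List using (List; []; _∷_; _++_; map)
open import Data.List.Relation.Unary.All using (All)
open import Data.List.Relation.Unary.Any using (Any)
open import Data.List.Relation.Unary.AllPairs using (AllPairs)
open import Data.List.Relation.Binary.Permutation.Propositional using (_↭_)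
open import Data.Sum using (_⊎_)
open import Data.Product using (Σ)
open import Relation.Binary.PropositionalEquality using (_≡_)
open import Relation.Nullary using (¬_)
open import Function using (_∘_)

module LMRL (Role : Set) (Fun : Set) (Pred : Set) where

  -- Subsets of the set of roles (classically every subset is decidable)

  Subset : Set
  Subset = Role → Bool

  ∅ : Subset
  ∅ = λ _ → false

  Full : Subset
  Full = λ _ → true

  ∁ : Subset → Subset
  ∁ R = not ∘ R

  _∩_ : Subset → Subset → Subset
  (R ∩ S) r = R r ∧ S r

  _⊆_ : Subset → Subset → Set
  R ⊆ S = ∀ r → R r ≡ true → S r ≡ true

  Disjoint : Subset → Subset → Set
  Disjoint R S = ∀ r → R r ≡ true → S r ≡ true → ⊥'
    where open import Data.Empty renaming (⊥ to ⊥')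

  _⁻¹[_] : (Role → Role) → Subset → Subset
  f ⁻¹[ R ] = R ∘ f

  DisjointCover : List Subset → Set
  DisjointCover Rs = AllPairs Disjoint Rs × (∀ r → Any (λ R → R r ≡ true) Rs)
    where open import Data.Product using (_×_)

  record Ultrafilter : Set₁ where
    field
      _∈U     : Subset → Set
      full    : Full ∈U
      proper  : ¬ (∅ ∈U)
      upward  : ∀ {R S} → R ⊆ S → R ∈U → S ∈U
      meet    : ∀ {R S} → R ∈U → S ∈U → (R ∩ S) ∈U
      ultra   : ∀ R → R ∈U ⊎ ∁ R ∈U

  open Ultrafilter public

  _∈_ : Subset → Ultrafilter → Set
  R ∈ 𝒰 = _∈U 𝒰 R

  _∉_ : Subset → Ultrafilter → Set
  R ∉ 𝒰 = ¬ (R ∈ 𝒰)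

  data Term : Set where
    var : ℕ → Term
    fn  : Fun → List Term → Term

  data Atom : Set where
    atom : Pred → List Term → Atom

  mutual
    substT : (ℕ → Term) → Term → Term
    substT σ (var x)   = σ x
    substT σ (fn f ts) = fn f (substTs σ ts)

    substTs : (ℕ → Term) → List Term → List Term
    substTs σ []       = []
    substTs σ (t ∷ ts) = substT σ t ∷ substTs σ ts

  ↑ : ℕ → Term
  ↑ x = var (suc x)

  exts : (ℕ → Term) → ℕ → Term
  exts σ zero    = var zero
  exts σ (suc x) = substT ↑ (σ x)

  data Formula : Set₁ where
    at   : Atom → Formula
    ¬[_]_ : (Role → Role) → Formula → Formula
    ∧[_]  : Ultrafilter → Formula → Formula → Formula
    ⊃[_,_] : (Role → Role) → Ultrafilter → Formula → Formula → Formula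
    ![_]  : Ultrafilter → Formula → Formula
    ∀[_]  : Ultrafilter → Formula → Formula     -- ∀_𝒰(λx.A), body uses de Bruijn index 0 for x

  substA : (ℕ → Term) → Atom → Atom
  substA σ (atom p ts) = atom p (substTs σ ts)

  substF : (ℕ → Term) → Formula → Formula
  substF σ (at a)           = at (substA σ a)
  substF σ (¬[ f ] A)       = ¬[ f ] substF σ A
  substF σ (∧[ 𝒰 ] A B)     = ∧[ 𝒰 ] (substF σ A) (substF σ B)
  substF σ (⊃[ f , 𝒰 ] A B) = ⊃[ f , 𝒰 ] (substF σ A) (substF σ B)
  substF σ (![ 𝒰 ] A)       = ![ 𝒰 ] (substF σ A)
  substF σ (∀[ 𝒰 ] A)       = ∀[ 𝒰 ] (substF (exts σ) A)

  _[0:=_] : Formula → Term → Formula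
  A [0:= t ] = substF σ A
    where
      σ : ℕ → Term
      σ zero    = t
      σ (suc x) = var x

  -- i-formulas and sequents (multisets, represented as lists up to ↭)

  record IFormula : Set₁ where
    constructor [_]_
    field
      roles   : Subset
      formula : Formula

  Sequent : Set₁
  Sequent = List IFormula

  _▸_ : Sequent → IFormula → Sequent
  Γ ▸ i = Γ ++ (i ∷ [])
  infixl 5 _▸_

  shiftI : IFormula → IFormula
  shiftI ([ R ] A) = [ R ] substF ↑ A

  data IsQuest : IFormula → Set₁ where
    quest : ∀ {R 𝒰 B} → R ∉ 𝒰 → IsQuest ([ R ] (![ 𝒰 ] B))

  infix 2 ⊢_
  data ⊢_ : Sequent → Set₁ where
    exch   : ∀ {Γ Δ} → Γ ↭ Δ → ⊢ Γ → ⊢ Δ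
    Id     : ∀ (a : Atom) (Rs : List Subset) → (R : Subset) → DisjointCover (R ∷ Rs)
           → ⊢ map (λ S → [ S ] at a) (R ∷ Rs)
    ¬-rule : ∀ {Γ R f A} → ⊢ Γ ▸ [ f ⁻¹[ R ] ] A → ⊢ Γ ▸ [ R ] (¬[ f ] A)
    ⊃-neg  : ∀ {Γ R f 𝒰 A B} → R ∉ 𝒰
           → ⊢ Γ ▸ [ f ⁻¹[ R ] ] A ▸ [ R ] B → ⊢ Γ ▸ [ R ] (⊃[ f , 𝒰 ] A B)
    ⊃-pos  : ∀ {Γ₁ Γ₂ R f 𝒰 A B} → R ∈ 𝒰
           → ⊢ Γ₁ ▸ [ f ⁻¹[ R ] ] A → ⊢ Γ₂ ▸ [ R ] B
           → ⊢ (Γ₁ ++ Γ₂) ▸ [ R ] (⊃[ f , 𝒰 ] A B)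
    ∧-neg₁ : ∀ {Γ R 𝒰 A B} → R ∉ 𝒰 → ⊢ Γ ▸ [ R ] A → ⊢ Γ ▸ [ R ] (∧[ 𝒰 ] A B)
    ∧-neg₂ : ∀ {Γ R 𝒰 A B} → R ∉ 𝒰 → ⊢ Γ ▸ [ R ] B → ⊢ Γ ▸ [ R ] (∧[ 𝒰 ] A B)
    ∧-pos  : ∀ {Γ R 𝒰 A B} → R ∈ 𝒰
           → ⊢ Γ ▸ [ R ] A → ⊢ Γ ▸ [ R ] B → ⊢ Γ ▸ [ R ] (∧[ 𝒰 ] A B)
    !-pos  : ∀ {Γ R 𝒰 A} → All IsQuest Γ → R ∈ 𝒰
           → ⊢ Γ ▸ [ R ] A → ⊢ Γ ▸ [ R ] (![ 𝒰 ] A)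
    !-weaken   : ∀ {Γ R 𝒰 A} → R ∉ 𝒰 → ⊢ Γ → ⊢ Γ ▸ [ R ] (![ 𝒰 ] A)
    !-derelict : ∀ {Γ R 𝒰 A} → R ∉ 𝒰 → ⊢ Γ ▸ [ R ] A → ⊢ Γ ▸ [ R ] (![ 𝒰 ] A)
    !-contract : ∀ {Γ R 𝒰 A} → R ∉ 𝒰
               → ⊢ Γ ▸ [ R ] (![ 𝒰 ] A) ▸ [ R ] (![ 𝒰 ] A) → ⊢ Γ ▸ [ R ] (![ 𝒰 ] A)
    ∀-neg  : ∀ {Γ R 𝒰 A} (t : Term) → R ∉ 𝒰
           → ⊢ Γ ▸ [ R ] (A [0:= t ]) → ⊢ Γ ▸ [ R ] (∀[ 𝒰 ] A)
    -- eigenvariable condition (x not free in Γ): Γ is shifted past the new variable 0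
    ∀-pos  : ∀ {Γ R 𝒰 A} → R ∈ 𝒰
           → ⊢ map shiftI Γ ▸ [ R ] A → ⊢ Γ ▸ [ R ] (∀[ 𝒰 ] A)

-- Call an i-formula void when its set of roles is empty. Void i-formulas are
-- inert in every derivation: no positive rule can introduce one, since ∅ lies
-- in no ultrafilter; a negative rule with a void principal formula only
-- produces void premises, as f⁻¹(∅) = ∅; and void members of an Id cover
-- contribute nothing to it. So erasing all void i-formulas from a derivation,
-- together with the negative rules introducing them, leaves a derivation.
module Submission where

open import Defs
open import Data.Bool using (true; false)
open import Data.Empty using (⊥; ⊥-elim)
open import Data.List using (List; []; _∷_; _++_; map)
open import Data.List.Properties using (++-assoc; map-++; map-∘; map-id; map-id-local)
open import Data.List.Relation.Unary.All using (All; []; _∷_)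
import Data.List.Relation.Unary.All as All
import Data.List.Relation.Unary.All.Properties as All
open import Data.List.Relation.Unary.Any using (Any; here)
import Data.List.Relation.Unary.Any.Properties as Any
open import Data.List.Relation.Unary.AllPairs using (AllPairs; _∷_)
open import Data.List.Relation.Binary.Permutation.Propositional
  using (_↭_; ↭-sym; ↭-refl; ↭-reflexive; ↭-prep; ↭-trans; ↭⇒↭ₛ)
open import Data.List.Relation.Binary.Permutation.Propositional.Properties
  using (All-resp-↭; Any-resp-↭; shift; drop-∷; ++⁺ˡ; ++⁺ʳ; ++-comm; map⁺)
import Data.List.Relation.Binary.Permutation.Setoid.Properties as Setoidₚ
open import Data.List.Membership.Propositional.Properties using (∈-∃++)
open import Data.Product using (∃-syntax; ∃₂; _×_; _,_; uncurry)
open import Data.Sum using (_⊎_; inj₁; inj₂)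
open import Function using (_∘_)
open import Relation.Binary.Definitions using (Symmetric)
open import Relation.Binary.PropositionalEquality
  using (_≡_; refl; sym; trans; subst; resp₂; setoid)

module _ {a} {A : Set a} where

  ∷↭++⁻ : ∀ (x : A) {ys} us vs → x ∷ ys ↭ us ++ vs →
          (∃[ us′ ] us ↭ x ∷ us′ × ys ↭ us′ ++ vs) ⊎
          (∃[ vs′ ] vs ↭ x ∷ vs′ × ys ↭ us ++ vs′)
  ∷↭++⁻ x us vs p with Any.++⁻ us (Any-resp-↭ p (here refl))
  ... | inj₁ x∈us with ∈-∃++ x∈us
  ...   | ws , zs , refl =
    inj₁ (ws ++ zs , shift x ws zs , drop-∷ (↭-trans p (++⁺ʳ vs (shift x ws zs))))
  ∷↭++⁻ x us vs p | inj₂ x∈vs with ∈-∃++ x∈vs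
  ...   | ws , zs , refl =
    inj₂ (ws ++ zs , shift x ws zs ,
          drop-∷ (↭-trans p (↭-trans (++⁺ˡ us (shift x ws zs)) (shift x us (ws ++ zs)))))

  record Refinement (xs ys us vs : List A) : Set a where
    field
      xs∩us xs∩vs ys∩us ys∩vs : List A
      xs-split : xs ↭ xs∩us ++ xs∩vs
      ys-split : ys ↭ ys∩us ++ ys∩vs
      us-split : us ↭ xs∩us ++ ys∩us
      vs-split : vs ↭ xs∩vs ++ ys∩vs

  ++↭++⇒Refinement : ∀ xs {ys} us vs → xs ++ ys ↭ us ++ vs → Refinement xs ys us vs
  ++↭++⇒Refinement [] us vs p = record
    { xs∩us = [] ; xs∩vs = [] ; ys∩us = us ; ys∩vs = vs
    ; xs-split = ↭-refl ; ys-split = p ; us-split = ↭-refl ; vs-split = ↭-refl }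
  ++↭++⇒Refinement (x ∷ xs) us vs p with ∷↭++⁻ x us vs p
  ... | inj₁ (us′ , us↭ , p′) = let open Refinement (++↭++⇒Refinement xs us′ vs p′) in record
    { xs∩us = x ∷ xs∩us ; xs∩vs = xs∩vs ; ys∩us = ys∩us ; ys∩vs = ys∩vs
    ; xs-split = ↭-prep x xs-split ; ys-split = ys-split
    ; us-split = ↭-trans us↭ (↭-prep x us-split) ; vs-split = vs-split }
  ... | inj₂ (vs′ , vs↭ , p′) = let open Refinement (++↭++⇒Refinement xs us vs′ p′) in record
    { xs∩us = xs∩us ; xs∩vs = x ∷ xs∩vs ; ys∩us = ys∩us ; ys∩vs = ys∩vs
    ; xs-split = ↭-trans (↭-prep x xs-split) (↭-sym (shift x xs∩us xs∩vs))
    ; ys-split = ys-split ; us-split = us-split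
    ; vs-split = ↭-trans vs↭ (↭-prep x vs-split) }

  AllPairs-resp-↭ : ∀ {ℓ} {R : A → A → Set ℓ} → Symmetric R →
                    ∀ {xs ys} → xs ↭ ys → AllPairs R xs → AllPairs R ys
  AllPairs-resp-↭ {R = R} R-sym p = Setoidₚ.AllPairs-resp-↭ (setoid A) R-sym (resp₂ R) (↭⇒↭ₛ p)

  AllPairs-++⁻ʳ : ∀ {ℓ} {R : A → A → Set ℓ} xs {ys} → AllPairs R (xs ++ ys) → AllPairs R ys
  AllPairs-++⁻ʳ []       rs       = rs
  AllPairs-++⁻ʳ (x ∷ xs) (_ ∷ rs) = AllPairs-++⁻ʳ xs rs

module _ {Role Fun Pred : Set} where
  open LMRL Role Fun Pred

  Empty : Subset → Set
  Empty R = ∀ r → R r ≡ false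

  Void : IFormula → Set
  Void X = Empty (IFormula.roles X)

  Empty⇒∌ : ∀ {R r} → Empty R → R r ≡ true → ⊥
  Empty⇒∌ {r = r} e Rr with trans (sym (e r)) Rr
  ... | ()

  Empty⇒∉ : ∀ 𝒰 {R} → Empty R → R ∉ 𝒰
  Empty⇒∉ 𝒰 e R∈𝒰 = proper 𝒰 (upward 𝒰 (λ r Rr → ⊥-elim (Empty⇒∌ e Rr)) R∈𝒰)

  Disjoint-sym : Symmetric Disjoint
  Disjoint-sym disj r Sr Rr = disj r Rr Sr

  DisjointCover-resp-↭ : ∀ {Ls Ms} → Ls ↭ Ms → DisjointCover Ls → DisjointCover Ms
  DisjointCover-resp-↭ p (disjoint , covers) =
    AllPairs-resp-↭ Disjoint-sym p disjoint , λ r → Any-resp-↭ p (covers r)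

  DisjointCover-++⁻ʳ : ∀ {Ks Ls} → All Empty Ks → DisjointCover (Ks ++ Ls) → DisjointCover Ls
  DisjointCover-++⁻ʳ {Ks} {Ls} empties (disjoint , covers) = AllPairs-++⁻ʳ Ks disjoint , covers′
    where
      covers′ : ∀ r → Any (λ S → S r ≡ true) Ls
      covers′ r with Any.++⁻ Ks (covers r)
      ... | inj₁ inKs = ⊥-elim (uncurry Empty⇒∌ (All.lookupAny empties inKs))
      ... | inj₂ inLs = inLs

  atomic : Atom → Subset → IFormula
  atomic a S = [ S ] at a

  -- The empty list covers no role, so it is not a cover as soon as a role
  -- exists; without a role, ⊢ [∅]a would be an instance of Id.
  Id-DisjointCover : Role → ∀ a {Ls} → DisjointCover Ls → ⊢ map (atomic a) Ls
  Id-DisjointCover r₀ a {[]}     (_ , covers) = ⊥-elim (Any.¬Any[] (covers r₀))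
  Id-DisjointCover r₀ a {R ∷ Rs} cover        = Id a Rs R cover

  record Padded (Δ Γ : Sequent) : Set₁ where
    constructor padded
    field
      {padding} : Sequent
      void      : All Void padding
      split     : Δ ↭ padding ++ Γ

  module _ {Δ Γ : Sequent} where

    Padded-resp-↭ : ∀ {Δ′} → Δ′ ↭ Δ → Padded Δ Γ → Padded Δ′ Γ
    Padded-resp-↭ q (padded void p) = padded void (↭-trans q p)

    Padded-▸ : ∀ {X} → Padded Δ Γ → Padded (Δ ▸ X) (Γ ▸ X)
    Padded-▸ {X} (padded {Ks} void p) =
      padded void (↭-trans (++⁺ʳ (X ∷ []) p) (↭-reflexive (++-assoc Ks Γ (X ∷ []))))

    Padded-void : ∀ {X} → Void X → Padded Δ Γ → Padded (Δ ▸ X) Γ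
    Padded-void {X} v (padded void p) = padded (v ∷ void) (↭-trans (++-comm Δ (X ∷ [])) (↭-prep X p))

    Padded-shift : Padded Δ Γ → Padded (map shiftI Δ) (map shiftI Γ)
    Padded-shift (padded {Ks} void p) =
      padded (All.map⁺ void) (↭-trans (map⁺ shiftI p) (↭-reflexive (map-++ shiftI Ks Γ)))

    Padded-All : ∀ {p} {P : IFormula → Set p} → Padded Δ Γ → All P Δ → All P Γ
    Padded-All (padded {Ks} _ p) ps = All.++⁻ʳ Ks (All-resp-↭ p ps)

  Padded-++⁻ : ∀ {Δ₁ Δ₂ Γ} → Padded (Δ₁ ++ Δ₂) Γ →
               ∃₂ λ Γ₁ Γ₂ → Γ₁ ++ Γ₂ ↭ Γ × Padded Δ₁ Γ₁ × Padded Δ₂ Γ₂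
  Padded-++⁻ {Δ₁} {Γ = Γ} (padded {Ks} void p) =
    let open Refinement (++↭++⇒Refinement Δ₁ Ks Γ p)
        void₁ , void₂ = All.++⁻ xs∩us (All-resp-↭ us-split void)
    in xs∩vs , ys∩vs , ↭-sym vs-split , padded void₁ xs-split , padded void₂ ys-split

  Padded-▸-cases : ∀ {Δ X Γ} → Padded (Δ ▸ X) Γ →
                   (Void X → Padded Δ Γ → ⊢ Γ) →
                   (∀ {Γ₀} → Padded Δ Γ₀ → ⊢ Γ₀ ▸ X) →
                   ⊢ Γ
  Padded-▸-cases {Δ} {X} {Γ} (padded {Ks} void p) in-padding in-context
    with ∷↭++⁻ X Ks Γ (↭-trans (++-comm (X ∷ []) Δ) p)
  ... | inj₁ (Ks′ , Ks↭ , Δ↭) =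
    let void′ = All-resp-↭ Ks↭ void in in-padding (All.head void′) (padded (All.tail void′) Δ↭)
  ... | inj₂ (Γ₀ , Γ↭ , Δ↭) =
    exch (↭-sym (↭-trans Γ↭ (++-comm (X ∷ []) Γ₀))) (in-context (padded void Δ↭))

  Id-Padded : Role → ∀ a {L Γ} → DisjointCover L → Padded (map (atomic a) L) Γ → ⊢ Γ
  Id-Padded r₀ a {L} {Γ} cover (padded {Ks} void p) =
    subst ⊢_ Γ-atomic (Id-DisjointCover r₀ a (DisjointCover-++⁻ʳ (All.map⁺ void) cover′))
    where
      Γ-atomic : map (atomic a) (map IFormula.roles Γ) ≡ Γ
      Γ-atomic = trans (sym (map-∘ Γ))
        (map-id-local (All.++⁻ʳ Ks (All-resp-↭ p (All.map⁺ (All.universal (λ _ → refl) L)))))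

      cover′ : DisjointCover (map IFormula.roles Ks ++ map IFormula.roles Γ)
      cover′ = DisjointCover-resp-↭
        (↭-trans (↭-reflexive (trans (sym (map-id L)) (map-∘ L)))
          (↭-trans (map⁺ IFormula.roles p) (↭-reflexive (map-++ IFormula.roles Ks Γ))))
        cover

  module _ (r₀ : Role) where

    ⊢-unpad : ∀ {Δ Γ} → ⊢ Δ → Padded Δ Γ → ⊢ Γ
    ⊢-unpad (exch q d) pad = ⊢-unpad d (Padded-resp-↭ q pad)
    ⊢-unpad (Id a Rs R cover) pad = Id-Padded r₀ a cover pad
    ⊢-unpad (¬-rule {f = f} d) pad = Padded-▸-cases pad
      (λ v pad′ → ⊢-unpad d (Padded-void (v ∘ f) pad′))
      (λ pad′ → ¬-rule (⊢-unpad d (Padded-▸ pad′)))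
    ⊢-unpad (⊃-neg {f = f} R∉𝒰 d) pad = Padded-▸-cases pad
      (λ v pad′ → ⊢-unpad d (Padded-void v (Padded-void (v ∘ f) pad′)))
      (λ pad′ → ⊃-neg R∉𝒰 (⊢-unpad d (Padded-▸ (Padded-▸ pad′))))
    ⊢-unpad (⊃-pos {𝒰 = 𝒰} R∈𝒰 d₁ d₂) pad = Padded-▸-cases pad
      (λ v _ → ⊥-elim (Empty⇒∉ 𝒰 v R∈𝒰))
      (λ pad′ → let Γ₁ , Γ₂ , split , pad₁ , pad₂ = Padded-++⁻ pad′ in
        exch (++⁺ʳ _ split) (⊃-pos R∈𝒰 (⊢-unpad d₁ (Padded-▸ pad₁)) (⊢-unpad d₂ (Padded-▸ pad₂))))
    ⊢-unpad (∧-neg₁ R∉𝒰 d) pad = Padded-▸-cases pad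
      (λ v pad′ → ⊢-unpad d (Padded-void v pad′))
      (λ pad′ → ∧-neg₁ R∉𝒰 (⊢-unpad d (Padded-▸ pad′)))
    ⊢-unpad (∧-neg₂ R∉𝒰 d) pad = Padded-▸-cases pad
      (λ v pad′ → ⊢-unpad d (Padded-void v pad′))
      (λ pad′ → ∧-neg₂ R∉𝒰 (⊢-unpad d (Padded-▸ pad′)))
    ⊢-unpad (∧-pos {𝒰 = 𝒰} R∈𝒰 d₁ d₂) pad = Padded-▸-cases pad
      (λ v _ → ⊥-elim (Empty⇒∉ 𝒰 v R∈𝒰))
      (λ pad′ → ∧-pos R∈𝒰 (⊢-unpad d₁ (Padded-▸ pad′)) (⊢-unpad d₂ (Padded-▸ pad′)))
    ⊢-unpad (!-pos {𝒰 = 𝒰} quests R∈𝒰 d) pad = Padded-▸-cases pad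
      (λ v _ → ⊥-elim (Empty⇒∉ 𝒰 v R∈𝒰))
      (λ pad′ → !-pos (Padded-All pad′ quests) R∈𝒰 (⊢-unpad d (Padded-▸ pad′)))
    ⊢-unpad (!-weaken R∉𝒰 d) pad = Padded-▸-cases pad
      (λ _ pad′ → ⊢-unpad d pad′)
      (λ pad′ → !-weaken R∉𝒰 (⊢-unpad d pad′))
    ⊢-unpad (!-derelict R∉𝒰 d) pad = Padded-▸-cases pad
      (λ v pad′ → ⊢-unpad d (Padded-void v pad′))
      (λ pad′ → !-derelict R∉𝒰 (⊢-unpad d (Padded-▸ pad′)))
    ⊢-unpad (!-contract R∉𝒰 d) pad = Padded-▸-cases pad
      (λ v pad′ → ⊢-unpad d (Padded-void v (Padded-void v pad′)))
      (λ pad′ → !-contract R∉𝒰 (⊢-unpad d (Padded-▸ (Padded-▸ pad′))))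
    ⊢-unpad (∀-neg t R∉𝒰 d) pad = Padded-▸-cases pad
      (λ v pad′ → ⊢-unpad d (Padded-void v pad′))
      (λ pad′ → ∀-neg t R∉𝒰 (⊢-unpad d (Padded-▸ pad′)))
    ⊢-unpad (∀-pos {𝒰 = 𝒰} R∈𝒰 d) pad = Padded-▸-cases pad
      (λ v _ → ⊥-elim (Empty⇒∉ 𝒰 v R∈𝒰))
      (λ pad′ → ∀-pos R∈𝒰 (⊢-unpad d (Padded-▸ (Padded-shift pad′))))

lemma9 : {Role Fun Pred : Set} → Role
       → let open LMRL Role Fun Pred in
         (Γ : Sequent) (A : Formula) → ⊢ Γ ▸ [ ∅ ] A → ⊢ Γ
lemma9 r₀ Γ A d = ⊢-unpad r₀ d (padded ((λ _ → refl) ∷ []) (++-comm Γ _))
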